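{- Let $p \geq 2$ and $k \geq 2$ be integers. For $n\ge 0$, let $d_{pk}(n)$ be the number of partitions of $n$ in which exactly one part appears at least $pk$ times (all other parts appear at most $pk-1$ times), and let $d_{p}(n,k,0)$ be the number of partitions of $n$ in which exactly one part divisible by $p$ appears at least $k$ times (every other part divisible by $p$ appears at most $k-1$ times), while parts not divisible by $p$ appear with unrestricted multiplicity. Then for all $n \geq 0$, $$d_{pk}(n) = d_{p}(n,k,0).$$ -}

module Defs where

open import Data.Nat using (ℕ; zero; suc; _+_; _*_; _≤ᵇ_)
open import Data.Nat.Divisibility using (_∣?_)
open import Data.Bool using (Bool; true; false; _∧_; if_then_else_)
open import Data.Vec using (Vec; []; _∷_)
open import Data.Product using (Σ; _×_)
open import Relation.Binary.PropositionalEquality using (_≡_)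
open import Relation.Nullary.Decidable using (⌊_⌋)

-- A partition of n is encoded by its multiplicity vector m : Vec ℕ n,
-- where the i-th entry (i = 0 .. n-1) is the multiplicity of the part i+1.
-- (Every part of a partition of n is in 1..n, so this encoding is a
-- bijection between partitions of n and vectors with weight n.)

weightFrom : ℕ → {l : ℕ} → Vec ℕ l → ℕ
weightFrom j []       = 0
weightFrom j (x ∷ xs) = j * x + weightFrom (suc j) xs

weight : {l : ℕ} → Vec ℕ l → ℕ
weight = weightFrom 1

countFrom : (ℕ → ℕ → Bool) → ℕ → {l : ℕ} → Vec ℕ l → ℕ
countFrom c j []       = 0
countFrom c j (x ∷ xs) = (if c j x then 1 else 0) + countFrom c (suc j) xs

countParts : (ℕ → ℕ → Bool) → {l : ℕ} → Vec ℕ l → ℕ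
countParts c = countFrom c 1

isDpk : ℕ → ℕ → {l : ℕ} → Vec ℕ l → Bool
isDpk p k m = countParts (λ part mult → (p * k) ≤ᵇ mult) m Data.Nat.≡ᵇ 1

isDp0 : ℕ → ℕ → {l : ℕ} → Vec ℕ l → Bool
isDp0 p k m = countParts (λ part mult → ⌊ p ∣? part ⌋ ∧ (k ≤ᵇ mult)) m Data.Nat.≡ᵇ 1

Dpk : ℕ → ℕ → ℕ → Set
Dpk p k n = Σ (Vec ℕ n) (λ m → (weight m ≡ n) × (isDpk p k m ≡ true))

Dp0 : ℕ → ℕ → ℕ → Set
Dp0 p k n = Σ (Vec ℕ n) (λ m → (weight m ≡ n) × (isDp0 p k m ≡ true))

-- Glaisher-type bijection with base p. Write every part as s₀ pⁱ with p ∤ s₀. Of the m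
-- copies of a part t, p ⌊m/p⌋ are merged p at a time into ⌊m/p⌋ copies of t p, and the
-- m % p < p leftover copies of t = s₀ pⁱ are broken into pⁱ copies of s₀ each. The leftovers
-- of s₀, s₀ p, s₀ p², … are the base-p digits of the new multiplicity of s₀, so the map can
-- be undone. Both steps preserve the weight, and a multiple t p of p has multiplicity at
-- least k in the image exactly when t had multiplicity at least p k, which matches the
-- two "exactly one part" conditions.

module Submission where

open import Defs
open import Data.Nat using (ℕ; zero; suc; _+_; _*_; _∸_; _≤_; _<_; z≤n; s≤s; _≤ᵇ_; _≡ᵇ_; NonZero; _/_; _%_; _≤?_; _≟_)
open import Data.Nat.Properties
open import Data.Nat.DivMod
open import Data.Nat.Divisibility using (_∣_; _∣?_; divides; ∣m+n∣m⇒∣n; ∣⇒≤; quotient)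
open import Data.Bool using (Bool; true; false; _∧_; if_then_else_; T)
open import Data.Bool.Properties using (⇔→≡; T-≡)
import Data.Bool.Properties as Bool
open import Data.Vec using (Vec; []; _∷_)
open import Data.Product using (Σ; _×_; _,_)
open import Data.Sum using (inj₁; inj₂)
open import Data.Empty using (⊥-elim)
open import Relation.Binary.PropositionalEquality
open import Relation.Nullary using (yes; no; ¬_)
open import Relation.Nullary.Decidable using (⌊_⌋)
open import Function.Base using (_∘_)
open import Function.Bundles using (_⤖_; mk↔ₛ′; mk⇔; Equivalence)
open import Function.Properties.Inverse using (↔⇒⤖)
open import Algebra.Properties.CommutativeSemigroup +-commutativeSemigroup using (interchange)
import Axiom.UniquenessOfIdentityProofs as UIP

sumFrom : ℕ → ℕ → (ℕ → ℕ) → ℕ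
sumFrom j zero    g = 0
sumFrom j (suc l) g = g j + sumFrom (suc j) l g

sumFrom-cong : ∀ j l {g h : ℕ → ℕ} → (∀ s → j ≤ s → s < j + l → g s ≡ h s) →
               sumFrom j l g ≡ sumFrom j l h
sumFrom-cong j zero    eq = refl
sumFrom-cong j (suc l) eq =
  cong₂ _+_ (eq j ≤-refl (subst (j <_) (sym (+-suc j l)) (s≤s (m≤m+n j l))))
            (sumFrom-cong (suc j) l (λ s j<s s<j+l → eq s (<⇒≤ j<s) (subst (s <_) (sym (+-suc j l)) s<j+l)))

sumFrom-split : ∀ j a b g → sumFrom j (a + b) g ≡ sumFrom j a g + sumFrom (j + a) b g
sumFrom-split j zero    b g = cong (λ i → sumFrom i b g) (sym (+-identityʳ j))
sumFrom-split j (suc a) b g = begin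
    g j + sumFrom (suc j) (a + b) g
  ≡⟨ cong (g j +_) (sumFrom-split (suc j) a b g) ⟩
    g j + (sumFrom (suc j) a g + sumFrom (suc j + a) b g)
  ≡⟨ sym (+-assoc (g j) _ _) ⟩
    (g j + sumFrom (suc j) a g) + sumFrom (suc j + a) b g
  ≡⟨ cong (λ i → (g j + sumFrom (suc j) a g) + sumFrom i b g) (sym (+-suc j a)) ⟩
    (g j + sumFrom (suc j) a g) + sumFrom (j + suc a) b g ∎
  where open ≡-Reasoning

sumFrom-+ : ∀ j l (g h : ℕ → ℕ) → sumFrom j l (λ s → g s + h s) ≡ sumFrom j l g + sumFrom j l h
sumFrom-+ j zero    g h = refl
sumFrom-+ j (suc l) g h =
  trans (cong ((g j + h j) +_) (sumFrom-+ (suc j) l g h)) (interchange (g j) (h j) _ _)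

sumFrom-zeros : ∀ j l (g : ℕ → ℕ) → (∀ s → j ≤ s → s < j + l → g s ≡ 0) → sumFrom j l g ≡ 0
sumFrom-zeros j l g eq = trans (sumFrom-cong j l eq) (sumFrom-0 j l)
  where
  sumFrom-0 : ∀ j l → sumFrom j l (λ _ → 0) ≡ 0
  sumFrom-0 j zero    = refl
  sumFrom-0 j (suc l) = sumFrom-0 (suc j) l

term≤sumFrom : ∀ j l (g : ℕ → ℕ) s → j ≤ s → s < j + l → g s ≤ sumFrom j l g
term≤sumFrom j zero    g s j≤s s<j = ⊥-elim (<-irrefl refl (≤-<-trans j≤s (subst (s <_) (+-identityʳ j) s<j)))
term≤sumFrom j (suc l) g s j≤s s<j+l with m≤n⇒m<n∨m≡n j≤s
... | inj₂ refl = m≤m+n (g j) _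
... | inj₁ j<s  = ≤-trans (term≤sumFrom (suc j) l g s j<s (subst (s <_) (+-suc j l) s<j+l)) (m≤n+m _ (g j))

sumFrom-extend : ∀ M M' (g : ℕ → ℕ) → M ≤ M' → (∀ s → M < s → g s ≡ 0) → sumFrom 1 M' g ≡ sumFrom 1 M g
sumFrom-extend M M' g M≤M' beyond = begin
    sumFrom 1 M' g                           ≡⟨ cong (λ l → sumFrom 1 l g) (sym (m+[n∸m]≡n M≤M')) ⟩
    sumFrom 1 (M + (M' ∸ M)) g               ≡⟨ sumFrom-split 1 M (M' ∸ M) g ⟩
    sumFrom 1 M g + sumFrom (suc M) (M' ∸ M) g ≡⟨ cong (sumFrom 1 M g +_) (sumFrom-zeros (suc M) (M' ∸ M) g λ s M<s _ → beyond s M<s) ⟩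
    sumFrom 1 M g + 0                        ≡⟨ +-identityʳ _ ⟩
    sumFrom 1 M g                            ∎
  where open ≡-Reasoning

-- A multiplicity vector read as a function from part sizes: the entry at index i is
-- the value at j + i, and every other number (including 0 when j = 1) is sent to 0.
tabulateFrom : ℕ → (l : ℕ) → (ℕ → ℕ) → Vec ℕ l
tabulateFrom j zero    h = []
tabulateFrom j (suc l) h = h j ∷ tabulateFrom (suc j) l h

lookupFrom : ℕ → ∀ {l} → Vec ℕ l → ℕ → ℕ
lookupFrom j []       s = 0
lookupFrom j (x ∷ xs) s with s ≟ j
... | yes _ = x
... | no  _ = lookupFrom (suc j) xs s

lookupFrom-beyond : ∀ j {l} (v : Vec ℕ l) s → j + l ≤ s → lookupFrom j v s ≡ 0
lookupFrom-beyond j []                 s le = refl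
lookupFrom-beyond j {suc l} (x ∷ xs) s le with s ≟ j
... | yes refl = ⊥-elim (<-irrefl refl (≤-<-trans le (subst (s <_) (sym (+-suc s l)) (s≤s (m≤m+n s l)))))
... | no  _    = lookupFrom-beyond (suc j) xs s (subst (_≤ s) (+-suc j l) le)

lookupFrom-tabulateFrom : ∀ j l h s → j ≤ s → s < j + l → lookupFrom j (tabulateFrom j l h) s ≡ h s
lookupFrom-tabulateFrom j zero    h s j≤s s<j = ⊥-elim (<-irrefl refl (≤-<-trans j≤s (subst (s <_) (+-identityʳ j) s<j)))
lookupFrom-tabulateFrom j (suc l) h s j≤s s<j+l with s ≟ j
... | yes refl = refl
... | no  s≢j  =
  lookupFrom-tabulateFrom (suc j) l h s (≤∧≢⇒< j≤s (λ j≡s → s≢j (sym j≡s))) (subst (s <_) (+-suc j l) s<j+l)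

tabulateFrom-cong : ∀ j l {h h' : ℕ → ℕ} → (∀ s → j ≤ s → s < j + l → h s ≡ h' s) →
                    tabulateFrom j l h ≡ tabulateFrom j l h'
tabulateFrom-cong j zero    eq = refl
tabulateFrom-cong j (suc l) eq =
  cong₂ _∷_ (eq j ≤-refl (subst (j <_) (sym (+-suc j l)) (s≤s (m≤m+n j l))))
            (tabulateFrom-cong (suc j) l (λ s j<s s<j+l → eq s (<⇒≤ j<s) (subst (s <_) (sym (+-suc j l)) s<j+l)))

tabulateFrom-lookupFrom : ∀ j {l} (v : Vec ℕ l) → tabulateFrom j l (lookupFrom j v) ≡ v
tabulateFrom-lookupFrom j [] = refl
tabulateFrom-lookupFrom j {suc l} (x ∷ xs) =
  cong₂ _∷_ head (trans (tabulateFrom-cong (suc j) l tail) (tabulateFrom-lookupFrom (suc j) xs))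
  where
  head : lookupFrom j (x ∷ xs) j ≡ x
  head with j ≟ j
  ... | yes _   = refl
  ... | no  j≢j = ⊥-elim (j≢j refl)
  tail : ∀ s → suc j ≤ s → s < suc j + l → lookupFrom j (x ∷ xs) s ≡ lookupFrom (suc j) xs s
  tail s j<s _ with s ≟ j
  ... | yes refl = ⊥-elim (<-irrefl refl j<s)
  ... | no  _    = refl

weightFrom-tabulateFrom : ∀ j l h → weightFrom j (tabulateFrom j l h) ≡ sumFrom j l (λ s → s * h s)
weightFrom-tabulateFrom j zero    h = refl
weightFrom-tabulateFrom j (suc l) h = cong (j * h j +_) (weightFrom-tabulateFrom (suc j) l h)

countFrom-tabulateFrom : ∀ (c : ℕ → ℕ → Bool) j l h →
                         countFrom c j (tabulateFrom j l h) ≡ sumFrom j l (λ s → if c s (h s) then 1 else 0)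
countFrom-tabulateFrom c j zero    h = refl
countFrom-tabulateFrom c j (suc l) h = cong ((if c j (h j) then 1 else 0) +_) (countFrom-tabulateFrom c (suc j) l h)

countParts≡sumFrom : ∀ c {N} (v : Vec ℕ N) →
                     countParts c v ≡ sumFrom 1 N (λ s → if c s (lookupFrom 1 v s) then 1 else 0)
countParts≡sumFrom c {N} v = trans (cong (countParts c) (sym (tabulateFrom-lookupFrom 1 v)))
                                   (countFrom-tabulateFrom c 1 N (lookupFrom 1 v))

weight≡sumFrom : ∀ {N} (v : Vec ℕ N) → weight v ≡ sumFrom 1 N (λ s → s * lookupFrom 1 v s)
weight≡sumFrom {N} v = trans (cong weight (sym (tabulateFrom-lookupFrom 1 v)))
                             (weightFrom-tabulateFrom 1 N (lookupFrom 1 v))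

partition-≡ : ∀ {N} {Q : Vec ℕ N → Bool} {v v' : Vec ℕ N}
              {a : weight v ≡ N} {a' : weight v' ≡ N} {b : Q v ≡ true} {b' : Q v' ≡ true} →
              v ≡ v' → _≡_ {A = Σ (Vec ℕ N) (λ m → (weight m ≡ N) × (Q m ≡ true))} (v , a , b) (v' , a' , b')
partition-≡ {a = a} {a'} {b} {b'} refl
  with ≡-irrelevant a a' | UIP.Decidable⇒UIP.≡-irrelevant Bool._≟_ b b'
... | refl | refl = refl

[m+n*o]/n≡o : ∀ m {n} o .{{_ : NonZero n}} → m < n → (m + n * o) / n ≡ o
[m+n*o]/n≡o m {n} o m<n = begin
    (m + n * o) / n   ≡⟨ cong (λ x → (m + x) / n) (*-comm n o) ⟩
    (m + o * n) / n   ≡⟨ +-distrib-/ m (o * n) remainders<n ⟩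
    m / n + o * n / n ≡⟨ cong₂ _+_ (m<n⇒m/n≡0 m<n) (m*n/n≡m o n) ⟩
    o                 ∎
  where
  open ≡-Reasoning
  remainders<n : m % n + (o * n) % n < n
  remainders<n = subst (_< n) (sym (cong₂ _+_ (m<n⇒m%n≡m m<n) (m*n%n≡0 o n))) (subst (_< n) (sym (+-identityʳ m)) m<n)

[m+n*o]%n≡m : ∀ m {n} o .{{_ : NonZero n}} → m < n → (m + n * o) % n ≡ m
[m+n*o]%n≡m m {n} o m<n = begin
    (m + n * o) % n ≡⟨ cong (λ x → (m + x) % n) (*-comm n o) ⟩
    (m + o * n) % n ≡⟨ [m+kn]%n≡m%n m o n ⟩
    m % n           ≡⟨ m<n⇒m%n≡m m<n ⟩
    m               ∎
  where open ≡-Reasoning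

m%n+n*[m/n]≡m : ∀ m n .{{_ : NonZero n}} → m % n + n * (m / n) ≡ m
m%n+n*[m/n]≡m m n = trans (cong (m % n +_) (*-comm n (m / n))) (sym (m≡m%n+[m/n]*n m n))

m*n*[o/n]≤m*o : ∀ m n o .{{_ : NonZero n}} → (m * n) * (o / n) ≤ m * o
m*n*[o/n]≤m*o m n o = subst (_≤ m * o) reassociate (*-monoʳ-≤ m (m/n*n≤m o n))
  where
  reassociate : m * (o / n * n) ≡ m * n * (o / n)
  reassociate = trans (cong (m *_) (*-comm (o / n) n)) (sym (*-assoc m n (o / n)))

n∤m*n+o : ∀ m {n} o → 0 < o → o < n → ¬ n ∣ (m * n + o)
n∤m*n+o m zero    () o<n n∣
n∤m*n+o m (suc o) 0<o o<n n∣ = <-irrefl refl (<-≤-trans o<n (∣⇒≤ (∣m+n∣m⇒∣n n∣ (divides m refl))))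

k≤ᵇm/n≡n*k≤ᵇm : ∀ k m n .{{_ : NonZero n}} → (k ≤ᵇ m / n) ≡ (n * k ≤ᵇ m)
k≤ᵇm/n≡n*k≤ᵇm k m n = ⇔→≡ {z = true} (mk⇔ (viaT to) (viaT from))
  where
  viaT : ∀ {b c} → (T b → T c) → b ≡ true → c ≡ true
  viaT f = Equivalence.to T-≡ ∘ f ∘ Equivalence.from T-≡
  to : T (k ≤ᵇ m / n) → T (n * k ≤ᵇ m)
  to k≤m/n = ≤⇒≤ᵇ (subst (_≤ m) (*-comm k n) (≤-trans (*-monoˡ-≤ n (≤ᵇ⇒≤ k (m / n) k≤m/n)) (m/n*n≤m m n)))
  from : T (n * k ≤ᵇ m) → T (k ≤ᵇ m / n)
  from nk≤m =
    ≤⇒≤ᵇ (subst (_≤ m / n) (m*n/n≡m k n) (/-monoˡ-≤ n (subst (_≤ m) (*-comm n k) (≤ᵇ⇒≤ (n * k) m nk≤m))))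

k≤ᵇ0≡false : ∀ {k} → 1 ≤ k → (k ≤ᵇ 0) ≡ false
k≤ᵇ0≡false (s≤s _) = refl

mult≡0-of-bound : ∀ {N} s m → N < s → s * m ≤ N → m ≡ 0
mult≡0-of-bound s zero    N<s sm≤N = refl
mult≡0-of-bound s (suc m) N<s sm≤N = ⊥-elim (<-irrefl refl (<-≤-trans N<s (≤-trans (m≤m*n s (suc m)) sm≤N)))

module Glaisher (q : ℕ) where

  p : ℕ
  p = suc (suc q)

  s<s*p : ∀ s → 1 ≤ s → s < s * p
  s<s*p s 1≤s = subst (suc s ≤_) (sym (*-suc s (suc q)))
    (≤-trans (subst (_≤ s + s) (+-comm s 1) (+-monoʳ-≤ s 1≤s)) (+-monoʳ-≤ s (m≤m*n s (suc q))))

  1≤quotient : ∀ s t → 1 ≤ s → s ≡ t * p → 1 ≤ t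
  1≤quotient s zero    1≤s refl = 1≤s
  1≤quotient s (suc t) 1≤s _    = s≤s z≤n

  quotient<s : ∀ s t → 1 ≤ s → s ≡ t * p → t < s
  quotient<s s t 1≤s refl = s<s*p t (1≤quotient s t 1≤s refl)

  onMultiples : (ℕ → ℕ) → ℕ → ℕ
  onMultiples h s with p ∣? s
  ... | yes _ = h s
  ... | no  _ = 0

  offMultiples : (ℕ → ℕ) → ℕ → ℕ
  offMultiples h s with p ∣? s
  ... | yes _ = 0
  ... | no  _ = h s

  on+off : ∀ h s → h s ≡ onMultiples h s + offMultiples h s
  on+off h s with p ∣? s
  ... | yes _ = sym (+-identityʳ _)
  ... | no  _ = refl

  onMultiples-*p : ∀ h t → onMultiples h (t * p) ≡ h (t * p)
  onMultiples-*p h t with p ∣? (t * p)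
  ... | yes _  = refl
  ... | no  p∤ = ⊥-elim (p∤ (divides t refl))

  onMultiples-∤ : ∀ h s → ¬ p ∣ s → onMultiples h s ≡ 0
  onMultiples-∤ h s p∤s with p ∣? s
  ... | yes p∣s = ⊥-elim (p∤s p∣s)
  ... | no  _   = refl

  onMultiples-beyond : ∀ {N} h → (∀ t → N < t * p → h (t * p) ≡ 0) → ∀ s → N < s → onMultiples h s ≡ 0
  onMultiples-beyond h beyond s N<s with p ∣? s
  ... | yes (divides t refl) = beyond t N<s
  ... | no  _                = refl

  offMultiples-cong : ∀ h h' → (∀ s → ¬ p ∣ s → h s ≡ h' s) → ∀ s → offMultiples h s ≡ offMultiples h' s
  offMultiples-cong h h' eq s with p ∣? s
  ... | yes _   = refl
  ... | no  p∤s = eq s p∤s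

  if-∣∧-≡-onMultiples : ∀ (b : ℕ → Bool) s →
                        (if ⌊ p ∣? s ⌋ ∧ b s then 1 else 0) ≡ onMultiples (λ s → if b s then 1 else 0) s
  if-∣∧-≡-onMultiples b s with p ∣? s
  ... | yes _ = refl
  ... | no  _ = refl

  sumFrom-onMultiples-reindex : ∀ M h → sumFrom 1 (M * p) (onMultiples h) ≡ sumFrom 1 M (λ t → h (t * p))
  sumFrom-onMultiples-reindex zero    h = refl
  sumFrom-onMultiples-reindex (suc M) h = begin
      sumFrom 1 (p + M * p) (onMultiples h)
    ≡⟨ cong (λ l → sumFrom 1 l (onMultiples h)) (+-comm p (M * p)) ⟩
      sumFrom 1 (M * p + p) (onMultiples h)
    ≡⟨ sumFrom-split 1 (M * p) p (onMultiples h) ⟩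
      sumFrom 1 (M * p) (onMultiples h) + sumFrom (suc (M * p)) p (onMultiples h)
    ≡⟨ cong₂ _+_ (sumFrom-onMultiples-reindex M h) lastBlock ⟩
      sumFrom 1 M (λ t → h (t * p)) + sumFrom (suc M) 1 (λ t → h (t * p))
    ≡⟨ sym (sumFrom-split 1 M 1 (λ t → h (t * p))) ⟩
      sumFrom 1 (M + 1) (λ t → h (t * p))
    ≡⟨ cong (λ l → sumFrom 1 l (λ t → h (t * p))) (+-comm M 1) ⟩
      sumFrom 1 (suc M) (λ t → h (t * p)) ∎
    where
    open ≡-Reasoning
    j : ℕ
    j = suc (M * p)
    interior : ∀ s → j ≤ s → s < j + suc q → onMultiples h s ≡ 0
    interior s j≤s s<j+q =
      onMultiples-∤ h s (subst (λ x → ¬ p ∣ x) (m+[n∸m]≡n (<⇒≤ j≤s)) (n∤m*n+o M (s ∸ M * p) 0<r r<p))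
      where
      0<r : 0 < s ∸ M * p
      0<r = m<n⇒0<n∸m j≤s
      r<p : s ∸ M * p < p
      r<p = subst (s ∸ M * p <_) (m+n∸m≡n (M * p) p)
              (∸-monoˡ-< (subst (s <_) (sym (+-suc (M * p) (suc q))) s<j+q) (<⇒≤ j≤s))
    lastBlock : sumFrom j p (onMultiples h) ≡ sumFrom (suc M) 1 (λ t → h (t * p))
    lastBlock = begin
        sumFrom j p (onMultiples h)
      ≡⟨ cong (λ l → sumFrom j l (onMultiples h)) (+-comm 1 (suc q)) ⟩
        sumFrom j (suc q + 1) (onMultiples h)
      ≡⟨ sumFrom-split j (suc q) 1 (onMultiples h) ⟩
        sumFrom j (suc q) (onMultiples h) + (onMultiples h (j + suc q) + 0)
      ≡⟨ cong₂ _+_ (sumFrom-zeros j (suc q) (onMultiples h) interior)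
                   (cong (_+ 0) (trans (cong (onMultiples h) j+q≡[1+M]*p) (onMultiples-*p h (suc M)))) ⟩
        0 + (h (suc M * p) + 0) ∎
      where
      j+q≡[1+M]*p : j + suc q ≡ suc M * p
      j+q≡[1+M]*p = trans (+-comm j (suc q)) (cong suc (+-suc q (M * p)))

  -- For p ∤ s₀ and r ≥ i, descend r g (s₀ pⁱ) = g s₀ / pⁱ; the fuel s of unpack suffices.
  descend : ℕ → (ℕ → ℕ) → ℕ → ℕ
  descend zero    g s = g s
  descend (suc r) g s with p ∣? s
  ... | yes p∣s = descend r g (quotient p∣s) / p
  ... | no  _   = g s

  unpack : (ℕ → ℕ) → ℕ → ℕ
  unpack g s = descend s g s

  descend-fuel : ∀ g r r' s → 1 ≤ s → s ≤ r → s ≤ r' → descend r g s ≡ descend r' g s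
  descend-fuel g zero    r'       s 1≤s s≤0 _   = ⊥-elim (<-irrefl refl (≤-trans 1≤s s≤0))
  descend-fuel g (suc r) zero     s 1≤s _   s≤0 = ⊥-elim (<-irrefl refl (≤-trans 1≤s s≤0))
  descend-fuel g (suc r) (suc r') s 1≤s s≤r s≤r' with p ∣? s
  ... | yes (divides t s≡tp) =
        cong (_/ p) (descend-fuel g r r' t (1≤quotient s t 1≤s s≡tp)
                                   (≤-pred (<-≤-trans (quotient<s s t 1≤s s≡tp) s≤r))
                                   (≤-pred (<-≤-trans (quotient<s s t 1≤s s≡tp) s≤r')))
  ... | no  _ = refl

  descend-*p : ∀ g r t → descend (suc r) g (t * p) ≡ descend r g t / p
  descend-*p g r t with p ∣? (t * p)
  ... | yes (divides u tp≡up) = cong (λ x → descend r g x / p) (*-cancelʳ-≡ u t p (sym tp≡up))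
  ... | no  p∤                = ⊥-elim (p∤ (divides t refl))

  descend-cong : ∀ g g' r s → (∀ x → 1 ≤ x → x ≤ s → g x ≡ g' x) → 1 ≤ s → descend r g s ≡ descend r g' s
  descend-cong g g' zero    s eq 1≤s = eq s 1≤s ≤-refl
  descend-cong g g' (suc r) s eq 1≤s with p ∣? s
  ... | yes (divides t s≡tp) =
        cong (_/ p) (descend-cong g g' r t (λ x 1≤x x≤t → eq x 1≤x (≤-trans x≤t (<⇒≤ (quotient<s s t 1≤s s≡tp))))
                                            (1≤quotient s t 1≤s s≡tp))
  ... | no  _ = eq s 1≤s ≤-refl

  unpack-*p : ∀ g t → 1 ≤ t → unpack g (t * p) ≡ unpack g t / p
  unpack-*p g t 1≤t = begin
      descend (t * p) g (t * p)       ≡⟨ descend-fuel g (t * p) (suc (t * p)) (t * p) 1≤tp ≤-refl (n≤1+n _) ⟩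
      descend (suc (t * p)) g (t * p) ≡⟨ descend-*p g (t * p) t ⟩
      descend (t * p) g t / p         ≡⟨ cong (_/ p) (descend-fuel g (t * p) t t 1≤t (m≤m*n t p) ≤-refl) ⟩
      descend t g t / p               ∎
    where
    open ≡-Reasoning
    1≤tp = ≤-trans 1≤t (m≤m*n t p)

  unpack-∤ : ∀ g s → ¬ p ∣ s → unpack g s ≡ g s
  unpack-∤ g zero    p∤0 = ⊥-elim (p∤0 (divides 0 refl))
  unpack-∤ g (suc r) p∤s with p ∣? suc r
  ... | yes p∣s = ⊥-elim (p∤s p∣s)
  ... | no  _   = refl

  -- Inverse of merge: each part s p of g splits into p parts s, and s = s₀ pⁱ (p ∤ s₀)
  -- receives the i-th base-p digit of g s₀ as further copies.
  unmerge : (ℕ → ℕ) → ℕ → ℕ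
  unmerge g s = p * g (s * p) + unpack g s % p

  unmerge-/p : ∀ g s → unmerge g s / p ≡ g (s * p)
  unmerge-/p g s = trans (cong (_/ p) (+-comm (p * g (s * p)) (unpack g s % p)))
                         ([m+n*o]/n≡o (unpack g s % p) (g (s * p)) (m%n<n (unpack g s) p))

  unmerge-%p : ∀ g s → unmerge g s % p ≡ unpack g s % p
  unmerge-%p g s = trans (cong (_% p) (+-comm (p * g (s * p)) _))
                         ([m+n*o]%n≡m (unpack g s % p) (g (s * p)) (m%n<n (unpack g s) p))

  module Bounded (N : ℕ) where

    VanishesBeyond : (ℕ → ℕ) → Set
    VanishesBeyond f = ∀ s → N < s → f s ≡ 0

    weightTo : (ℕ → ℕ) → ℕ
    weightTo f = sumFrom 1 N (λ s → s * f s)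

    sumFrom-on+off : ∀ h → sumFrom 1 N h ≡ sumFrom 1 N (onMultiples h) + sumFrom 1 N (offMultiples h)
    sumFrom-on+off h = trans (sumFrom-cong 1 N (λ s _ _ → on+off h s)) (sumFrom-+ 1 N (onMultiples h) (offMultiples h))

    sumFrom-onMultiples : ∀ h → VanishesBeyond (onMultiples h) →
                          sumFrom 1 N (onMultiples h) ≡ sumFrom 1 N (λ t → h (t * p))
    sumFrom-onMultiples h beyond =
      trans (sym (sumFrom-extend N (N * p) (onMultiples h) (m≤m*n N p) beyond)) (sumFrom-onMultiples-reindex N h)

    sumFrom-offMultiples-cong : ∀ h h' → (∀ s → ¬ p ∣ s → h s ≡ h' s) →
                                sumFrom 1 N (offMultiples h) ≡ sumFrom 1 N (offMultiples h')
    sumFrom-offMultiples-cong h h' eq = sumFrom-cong 1 N (λ s _ _ → offMultiples-cong h h' eq s)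

    -- Σ s X s = Σ s a s + Σ (s p) X (s p): the second sum is the multiple-of-p part of the first.
    weighted-telescope : ∀ (X a : ℕ → ℕ) → (∀ s → 1 ≤ s → s ≤ N → X s ≡ a s + p * X (s * p)) →
                         VanishesBeyond X →
                         sumFrom 1 N (λ s → s * a s) ≡ sumFrom 1 N (offMultiples (λ s → s * X s))
    weighted-telescope X a step beyond =
      +-cancelʳ-≡ (sumFrom 1 N (onMultiples sX)) _ _
        (trans (sym unroll) (trans (sumFrom-on+off sX) (+-comm (sumFrom 1 N (onMultiples sX)) _)))
      where
      sX : ℕ → ℕ
      sX s = s * X s
      sX-step : ∀ s → 1 ≤ s → s < 1 + N → sX s ≡ s * a s + sX (s * p)
      sX-step s 1≤s s≤N = begin
          s * X s                     ≡⟨ cong (s *_) (step s 1≤s (≤-pred s≤N)) ⟩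
          s * (a s + p * X (s * p))   ≡⟨ *-distribˡ-+ s (a s) _ ⟩
          s * a s + s * (p * X (s * p)) ≡⟨ cong (s * a s +_) (sym (*-assoc s p _)) ⟩
          s * a s + sX (s * p)        ∎
        where open ≡-Reasoning
      sX-beyond : VanishesBeyond (onMultiples sX)
      sX-beyond = onMultiples-beyond sX (λ t N<tp → trans (cong (t * p *_) (beyond (t * p) N<tp)) (*-zeroʳ (t * p)))
      unroll : sumFrom 1 N sX ≡ sumFrom 1 N (λ s → s * a s) + sumFrom 1 N (onMultiples sX)
      unroll = trans (sumFrom-cong 1 N sX-step)
               (trans (sumFrom-+ 1 N (λ s → s * a s) (λ s → sX (s * p)))
                      (cong (sumFrom 1 N (λ s → s * a s) +_) (sym (sumFrom-onMultiples sX sX-beyond))))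

    part*mult≤N : ∀ g → VanishesBeyond g → weightTo g ≡ N → ∀ s → s * g s ≤ N
    part*mult≤N g beyond weight≡N zero = z≤n
    part*mult≤N g beyond weight≡N (suc s) with suc s ≤? N
    ... | yes s≤N = subst (suc s * g (suc s) ≤_) weight≡N
                      (term≤sumFrom 1 N (λ s → s * g s) (suc s) (s≤s z≤n) (s≤s s≤N))
    ... | no  s≰N rewrite beyond (suc s) (≰⇒> s≰N) | *-zeroʳ s = z≤n

    -- pack f s = Σᵢ pⁱ (f (s pⁱ) % p), computed with fuel that is ample once f vanishes beyond N
    packWithin : ℕ → (ℕ → ℕ) → ℕ → ℕ
    packWithin zero    f s = 0
    packWithin (suc r) f s = f s % p + p * packWithin r f (s * p)

    pack : (ℕ → ℕ) → ℕ → ℕ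
    pack = packWithin (suc N)

    packWithin-beyond : ∀ f → VanishesBeyond f → ∀ r → VanishesBeyond (packWithin r f)
    packWithin-beyond f beyond zero    s N<s = refl
    packWithin-beyond f beyond (suc r) s N<s
      rewrite beyond s N<s | packWithin-beyond f beyond r (s * p) (<-≤-trans N<s (m≤m*n s p)) | *-zeroʳ p = refl

    packWithin-stable : ∀ f → VanishesBeyond f → ∀ r s → 1 ≤ s → N < s + r →
                        packWithin r f s ≡ packWithin (suc r) f s
    packWithin-stable f beyond zero    s 1≤s N<s
      rewrite beyond s (subst (N <_) (+-identityʳ s) N<s) | *-zeroʳ p = refl
    packWithin-stable f beyond (suc r) s 1≤s N<s+r =
      cong (λ x → f s % p + p * x) (packWithin-stable f beyond r (s * p) (≤-trans 1≤s (m≤m*n s p)) N<sp+r)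
      where
      N<sp+r : N < s * p + r
      N<sp+r = <-≤-trans N<s+r (subst (_≤ s * p + r) (sym (+-suc s r)) (+-monoˡ-≤ r (s<s*p s 1≤s)))

    pack-step : ∀ f → VanishesBeyond f → ∀ s → 1 ≤ s → pack f s ≡ f s % p + p * pack f (s * p)
    pack-step f beyond s 1≤s =
      cong (λ x → f s % p + p * x) (packWithin-stable f beyond N (s * p) 1≤sp (+-monoˡ-≤ N 1≤sp))
      where 1≤sp = ≤-trans 1≤s (m≤m*n s p)

    pack-beyond : ∀ f → VanishesBeyond f → VanishesBeyond (pack f)
    pack-beyond f beyond = packWithin-beyond f beyond (suc N)

    merge : (ℕ → ℕ) → ℕ → ℕ
    merge f s with p ∣? s
    ... | yes p∣s = f (quotient p∣s) / p
    ... | no  _   = pack f s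

    merge-*p : ∀ f t → merge f (t * p) ≡ f t / p
    merge-*p f t with p ∣? (t * p)
    ... | yes (divides u tp≡up) = cong (λ x → f x / p) (*-cancelʳ-≡ u t p (sym tp≡up))
    ... | no  p∤                = ⊥-elim (p∤ (divides t refl))

    merge-∤ : ∀ f s → ¬ p ∣ s → merge f s ≡ pack f s
    merge-∤ f s p∤s with p ∣? s
    ... | yes p∣s = ⊥-elim (p∤s p∣s)
    ... | no  _   = refl

    descend-bound : ∀ g → VanishesBeyond g → weightTo g ≡ N → ∀ r s → s * descend r g s ≤ N
    descend-bound g beyond weight≡N zero    s = part*mult≤N g beyond weight≡N s
    descend-bound g beyond weight≡N (suc r) s with p ∣? s
    ... | yes (divides t refl) = ≤-trans (m*n*[o/n]≤m*o t p (descend r g t)) (descend-bound g beyond weight≡N r t)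
    ... | no  _                = part*mult≤N g beyond weight≡N s

    unpack-beyond : ∀ g → VanishesBeyond g → weightTo g ≡ N → VanishesBeyond (unpack g)
    unpack-beyond g beyond weight≡N s N<s = mult≡0-of-bound s (unpack g s) N<s (descend-bound g beyond weight≡N s s)

    [m/p]-beyond : ∀ f → VanishesBeyond f → weightTo f ≡ N → ∀ t → N < t * p → f t / p ≡ 0
    [m/p]-beyond f beyond weight≡N t N<tp =
      mult≡0-of-bound (t * p) (f t / p) N<tp (≤-trans (m*n*[o/n]≤m*o t p (f t)) (part*mult≤N f beyond weight≡N t))

    unpack-merge : ∀ f → VanishesBeyond f → ∀ r s → 1 ≤ s → s ≤ r → descend r (merge f) s ≡ pack f s
    unpack-merge f beyond zero    s 1≤s s≤0 = ⊥-elim (<-irrefl refl (≤-trans 1≤s s≤0))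
    unpack-merge f beyond (suc r) s 1≤s s≤r with p ∣? s
    ... | yes (divides t refl) = begin
          descend r (merge f) t / p         ≡⟨ cong (_/ p) (unpack-merge f beyond r t 1≤t t≤r) ⟩
          pack f t / p                      ≡⟨ cong (_/ p) (pack-step f beyond t 1≤t) ⟩
          (f t % p + p * pack f (t * p)) / p ≡⟨ [m+n*o]/n≡o (f t % p) (pack f (t * p)) (m%n<n (f t) p) ⟩
          pack f (t * p)                    ∎
      where
      open ≡-Reasoning
      1≤t = 1≤quotient (t * p) t 1≤s refl
      t≤r = ≤-pred (<-≤-trans (quotient<s (t * p) t 1≤s refl) s≤r)
    ... | no  p∤s = merge-∤ f s p∤s

    pack-%p : ∀ f → VanishesBeyond f → ∀ s → 1 ≤ s → pack f s % p ≡ f s % p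
    pack-%p f beyond s 1≤s =
      trans (cong (_% p) (pack-step f beyond s 1≤s)) ([m+n*o]%n≡m (f s % p) (pack f (s * p)) (m%n<n (f s) p))

    truncate : (ℕ → ℕ) → ℕ → ℕ
    truncate h = lookupFrom 1 (tabulateFrom 1 N h)

    truncate-agrees : ∀ h s → 1 ≤ s → s ≤ N → truncate h s ≡ h s
    truncate-agrees h s 1≤s s≤N = lookupFrom-tabulateFrom 1 N h s 1≤s (s≤s s≤N)

    truncate-beyond : ∀ h → VanishesBeyond (truncate h)
    truncate-beyond h s N<s = lookupFrom-beyond 1 (tabulateFrom 1 N h) s N<s

    unmerge-merge : ∀ f → VanishesBeyond f → weightTo f ≡ N → ∀ s → 1 ≤ s → s ≤ N →
                    unmerge (truncate (merge f)) s ≡ f s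
    unmerge-merge f beyond weight≡N s 1≤s s≤N = begin
        p * truncate (merge f) (s * p) + unpack (truncate (merge f)) s % p
      ≡⟨ cong₂ (λ x y → p * x + y % p) at-multiple (trans at-s (unpack-merge f beyond s s 1≤s ≤-refl)) ⟩
        p * (f s / p) + pack f s % p
      ≡⟨ cong (p * (f s / p) +_) (pack-%p f beyond s 1≤s) ⟩
        p * (f s / p) + f s % p
      ≡⟨ +-comm (p * (f s / p)) (f s % p) ⟩
        f s % p + p * (f s / p)
      ≡⟨ m%n+n*[m/n]≡m (f s) p ⟩
        f s ∎
      where
      open ≡-Reasoning
      at-multiple : truncate (merge f) (s * p) ≡ f s / p
      at-multiple with s * p ≤? N
      ... | yes sp≤N = trans (truncate-agrees (merge f) (s * p) (≤-trans 1≤s (m≤m*n s p)) sp≤N) (merge-*p f s)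
      ... | no  sp≰N = trans (truncate-beyond (merge f) (s * p) (≰⇒> sp≰N)) (sym ([m/p]-beyond f beyond weight≡N s (≰⇒> sp≰N)))
      at-s : unpack (truncate (merge f)) s ≡ unpack (merge f) s
      at-s = descend-cong _ _ s s (λ x 1≤x x≤s → truncate-agrees (merge f) x 1≤x (≤-trans x≤s s≤N)) 1≤s

    pack-unmerge : ∀ g → VanishesBeyond g → weightTo g ≡ N → ∀ r s → 1 ≤ s → N < s + r →
                   pack (truncate (unmerge g)) s ≡ unpack g s
    pack-unmerge g beyond weight≡N r s 1≤s N<s+r with s ≤? N
    ... | no s≰N = trans (pack-beyond _ (truncate-beyond (unmerge g)) s (≰⇒> s≰N))
                         (sym (unpack-beyond g beyond weight≡N s (≰⇒> s≰N)))
    pack-unmerge g beyond weight≡N zero s 1≤s N<s | yes s≤N =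
      ⊥-elim (<-irrefl refl (<-≤-trans N<s (subst (_≤ N) (sym (+-identityʳ s)) s≤N)))
    pack-unmerge g beyond weight≡N (suc r) s 1≤s N<s+r | yes s≤N = begin
        pack g' s
      ≡⟨ pack-step g' (truncate-beyond (unmerge g)) s 1≤s ⟩
        g' s % p + p * pack g' (s * p)
      ≡⟨ cong₂ (λ x y → x % p + p * y) (truncate-agrees (unmerge g) s 1≤s s≤N)
                                       (pack-unmerge g beyond weight≡N r (s * p) (≤-trans 1≤s (m≤m*n s p)) N<sp+r) ⟩
        unmerge g s % p + p * unpack g (s * p)
      ≡⟨ cong₂ (λ x y → x + p * y) (unmerge-%p g s) (unpack-*p g s 1≤s) ⟩
        unpack g s % p + p * (unpack g s / p)
      ≡⟨ m%n+n*[m/n]≡m (unpack g s) p ⟩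
        unpack g s ∎
      where
      open ≡-Reasoning
      g' = truncate (unmerge g)
      N<sp+r : N < s * p + r
      N<sp+r = <-≤-trans N<s+r (subst (_≤ s * p + r) (sym (+-suc s r)) (+-monoˡ-≤ r (s<s*p s 1≤s)))

    merge-unmerge : ∀ g → VanishesBeyond g → weightTo g ≡ N → ∀ s → 1 ≤ s → s ≤ N →
                    merge (truncate (unmerge g)) s ≡ g s
    merge-unmerge g beyond weight≡N s 1≤s s≤N with p ∣? s
    ... | yes (divides t refl) =
          trans (cong (_/ p) (truncate-agrees (unmerge g) t 1≤t (≤-trans (<⇒≤ (quotient<s (t * p) t 1≤s refl)) s≤N)))
                (unmerge-/p g t)
      where 1≤t = 1≤quotient (t * p) t 1≤s refl
    ... | no  p∤s = trans (pack-unmerge g beyond weight≡N (suc N) s 1≤s (≤-trans (s≤s (m≤n+m N s)) (≤-reflexive (sym (+-suc s N)))))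
                          (unpack-∤ g s p∤s)

    weightTo-merge : ∀ f → VanishesBeyond f → weightTo f ≡ N → weightTo (merge f) ≡ N
    weightTo-merge f beyond weight≡N = begin
        sumFrom 1 N sM
      ≡⟨ sumFrom-on+off sM ⟩
        sumFrom 1 N (onMultiples sM) + sumFrom 1 N (offMultiples sM)
      ≡⟨ cong₂ _+_ merged remainders ⟩
        sumFrom 1 N (λ t → t * (p * (f t / p))) + sumFrom 1 N (λ t → t * (f t % p))
      ≡⟨ sym (sumFrom-+ 1 N _ _) ⟩
        sumFrom 1 N (λ t → t * (p * (f t / p)) + t * (f t % p))
      ≡⟨ sumFrom-cong 1 N (λ t _ _ → recombine t) ⟩
        weightTo f
      ≡⟨ weight≡N ⟩
        N ∎
      where
      open ≡-Reasoning
      sM : ℕ → ℕ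
      sM s = s * merge f s
      sM-beyond : ∀ t → N < t * p → sM (t * p) ≡ 0
      sM-beyond t N<tp = trans (cong (t * p *_) (trans (merge-*p f t) ([m/p]-beyond f beyond weight≡N t N<tp))) (*-zeroʳ (t * p))
      merged : sumFrom 1 N (onMultiples sM) ≡ sumFrom 1 N (λ t → t * (p * (f t / p)))
      merged = trans (sumFrom-onMultiples sM (onMultiples-beyond sM sM-beyond))
        (sumFrom-cong 1 N (λ t _ _ → trans (cong (t * p *_) (merge-*p f t)) (*-assoc t p (f t / p))))
      remainders : sumFrom 1 N (offMultiples sM) ≡ sumFrom 1 N (λ t → t * (f t % p))
      remainders = trans (sumFrom-offMultiples-cong sM (λ s → s * pack f s) (λ s p∤s → cong (s *_) (merge-∤ f s p∤s)))
        (sym (weighted-telescope (pack f) (λ s → f s % p) (λ s 1≤s _ → pack-step f beyond s 1≤s) (pack-beyond f beyond)))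
      recombine : ∀ t → t * (p * (f t / p)) + t * (f t % p) ≡ t * f t
      recombine t = trans (sym (*-distribˡ-+ t _ _)) (cong (t *_) (trans (+-comm (p * (f t / p)) (f t % p)) (m%n+n*[m/n]≡m (f t) p)))

    weightTo-unmerge : ∀ g → VanishesBeyond g → weightTo g ≡ N → weightTo (unmerge g) ≡ N
    weightTo-unmerge g beyond weight≡N = begin
        sumFrom 1 N (λ s → s * unmerge g s)
      ≡⟨ sumFrom-cong 1 N (λ s _ _ → distribute s) ⟩
        sumFrom 1 N (λ s → sG (s * p) + s * (unpack g s % p))
      ≡⟨ sumFrom-+ 1 N _ _ ⟩
        sumFrom 1 N (λ s → sG (s * p)) + sumFrom 1 N (λ s → s * (unpack g s % p))
      ≡⟨ cong₂ _+_ (sym (sumFrom-onMultiples sG (onMultiples-beyond sG sG-beyond))) digits ⟩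
        sumFrom 1 N (onMultiples sG) + sumFrom 1 N (offMultiples sG)
      ≡⟨ sym (sumFrom-on+off sG) ⟩
        weightTo g
      ≡⟨ weight≡N ⟩
        N ∎
      where
      open ≡-Reasoning
      sG : ℕ → ℕ
      sG s = s * g s
      distribute : ∀ s → s * unmerge g s ≡ sG (s * p) + s * (unpack g s % p)
      distribute s = trans (*-distribˡ-+ s _ _) (cong (_+ s * (unpack g s % p)) (sym (*-assoc s p _)))
      sG-beyond : ∀ t → N < t * p → sG (t * p) ≡ 0
      sG-beyond t N<tp = trans (cong (t * p *_) (beyond (t * p) N<tp)) (*-zeroʳ (t * p))
      unpack-step : ∀ s → 1 ≤ s → s ≤ N → unpack g s ≡ unpack g s % p + p * unpack g (s * p)
      unpack-step s 1≤s _ = trans (sym (m%n+n*[m/n]≡m (unpack g s) p)) (cong (λ x → unpack g s % p + p * x) (sym (unpack-*p g s 1≤s)))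
      digits : sumFrom 1 N (λ s → s * (unpack g s % p)) ≡ sumFrom 1 N (offMultiples sG)
      digits =
        trans (weighted-telescope (unpack g) (λ s → unpack g s % p) unpack-step (unpack-beyond g beyond weight≡N))
        (sumFrom-offMultiples-cong (λ s → s * unpack g s) sG (λ s p∤s → cong (s *_) (unpack-∤ g s p∤s)))

    countTo : (ℕ → ℕ → Bool) → (ℕ → ℕ) → ℕ
    countTo c f = sumFrom 1 N (λ s → if c s (f s) then 1 else 0)

    countTo-cong : ∀ c f f' → (∀ s → 1 ≤ s → s ≤ N → f s ≡ f' s) → countTo c f ≡ countTo c f'
    countTo-cong c f f' eq = sumFrom-cong 1 N (λ s 1≤s s≤N → cong (λ x → if c s x then 1 else 0) (eq s 1≤s (≤-pred s≤N)))

    weightTo-lookupFrom : ∀ (v : Vec ℕ N) → weight v ≡ N → weightTo (lookupFrom 1 v) ≡ N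
    weightTo-lookupFrom v = trans (sym (weight≡sumFrom v))

    module Counting (k : ℕ) (1≤k : 1 ≤ k) where

      isPk : ℕ → ℕ → Bool
      isPk _ mult = p * k ≤ᵇ mult

      isP0 : ℕ → ℕ → Bool
      isP0 part mult = ⌊ p ∣? part ⌋ ∧ (k ≤ᵇ mult)

      countTo-merge : ∀ f → VanishesBeyond f → weightTo f ≡ N → countTo isP0 (merge f) ≡ countTo isPk f
      countTo-merge f beyond weight≡N = begin
          countTo isP0 (merge f)
        ≡⟨ sumFrom-cong 1 N (λ s _ _ → if-∣∧-≡-onMultiples (λ s → k ≤ᵇ merge f s) s) ⟩
          sumFrom 1 N (onMultiples indicator)
        ≡⟨ sumFrom-onMultiples indicator (onMultiples-beyond indicator indicator-beyond) ⟩
          sumFrom 1 N (λ t → indicator (t * p))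
        ≡⟨ sumFrom-cong 1 N (λ t _ _ → cong (λ b → if b then 1 else 0) (trans (cong (k ≤ᵇ_) (merge-*p f t)) (k≤ᵇm/n≡n*k≤ᵇm k (f t) p))) ⟩
          countTo isPk f ∎
        where
        open ≡-Reasoning
        indicator : ℕ → ℕ
        indicator s = if k ≤ᵇ merge f s then 1 else 0
        indicator-beyond : ∀ t → N < t * p → indicator (t * p) ≡ 0
        indicator-beyond t N<tp rewrite merge-*p f t | [m/p]-beyond f beyond weight≡N t N<tp | k≤ᵇ0≡false 1≤k = refl

      toDp0 : Dpk p k N → Dp0 p k N
      toDp0 (v , weight≡N , isDpk≡true) =
        tabulateFrom 1 N (merge f) ,
        trans (weightFrom-tabulateFrom 1 N (merge f)) (weightTo-merge f beyond f-weight) ,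
        trans (cong (_≡ᵇ 1) counts) isDpk≡true
        where
        f = lookupFrom 1 v
        beyond = lookupFrom-beyond 1 v
        f-weight = weightTo-lookupFrom v weight≡N
        counts : countParts isP0 (tabulateFrom 1 N (merge f)) ≡ countParts isPk v
        counts = trans (countFrom-tabulateFrom isP0 1 N (merge f))
                       (trans (countTo-merge f beyond f-weight) (sym (countParts≡sumFrom isPk v)))

      fromDp0 : Dp0 p k N → Dpk p k N
      fromDp0 (u , weight≡N , isDp0≡true) =
        tabulateFrom 1 N (unmerge g) , weight-u' , trans (cong (_≡ᵇ 1) counts) isDp0≡true
        where
        g = lookupFrom 1 u
        beyond = lookupFrom-beyond 1 u
        g-weight = weightTo-lookupFrom u weight≡N
        u' = tabulateFrom 1 N (unmerge g)
        weight-u' : weight u' ≡ N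
        weight-u' = trans (weightFrom-tabulateFrom 1 N (unmerge g)) (weightTo-unmerge g beyond g-weight)
        counts : countParts isPk u' ≡ countParts isP0 u
        counts = begin
            countParts isPk u'               ≡⟨ countParts≡sumFrom isPk u' ⟩
            countTo isPk (truncate (unmerge g))
              ≡⟨ sym (countTo-merge _ (truncate-beyond (unmerge g)) (weightTo-lookupFrom u' weight-u')) ⟩
            countTo isP0 (merge (truncate (unmerge g)))
              ≡⟨ countTo-cong isP0 _ g (merge-unmerge g beyond g-weight) ⟩
            countTo isP0 g                   ≡⟨ sym (countParts≡sumFrom isP0 u) ⟩
            countParts isP0 u                ∎
          where open ≡-Reasoning

      toDp0-fromDp0 : ∀ y → toDp0 (fromDp0 y) ≡ y
      toDp0-fromDp0 (u , weight≡N , _) = partition-≡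
        (trans (tabulateFrom-cong 1 N λ s 1≤s s<1+N →
                  merge-unmerge g (lookupFrom-beyond 1 u) (weightTo-lookupFrom u weight≡N) s 1≤s (≤-pred s<1+N))
               (tabulateFrom-lookupFrom 1 u))
        where g = lookupFrom 1 u

      fromDp0-toDp0 : ∀ x → fromDp0 (toDp0 x) ≡ x
      fromDp0-toDp0 (v , weight≡N , _) = partition-≡
        (trans (tabulateFrom-cong 1 N λ s 1≤s s<1+N →
                  unmerge-merge f (lookupFrom-beyond 1 v) (weightTo-lookupFrom v weight≡N) s 1≤s (≤-pred s<1+N))
               (tabulateFrom-lookupFrom 1 v))
        where f = lookupFrom 1 v

theorem7 : (p k : ℕ) → 2 ≤ p → 2 ≤ k → (n : ℕ) → Dpk p k n ⤖ Dp0 p k n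
theorem7 (suc (suc q)) k (s≤s (s≤s z≤n)) 2≤k n =
  ↔⇒⤖ (mk↔ₛ′ toDp0 fromDp0 toDp0-fromDp0 fromDp0-toDp0)
  where open Glaisher.Bounded.Counting q n k (<⇒≤ 2≤k)
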